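{- Let $F,H$ be graphs with $H\to F^{\bullet\bullet}$. Then $M_{F,H}(\varepsilon)=O(1/\varepsilon)$, i.e. there is a constant $C$ such that $M_{F,H}(\varepsilon)\le C/\varepsilon$ for all $\varepsilon\in(0,1)$.
   Context: The $2$-subdivision $F^{\bullet\bullet}$ of $F$ is obtained by replacing each edge of $F$ by a path of length $3$ (adding two new vertices on every edge); note $F^{\bullet\bullet}\to F$. A homomorphism $G\to\Gamma$ is a map $V(G)\to V(\Gamma)$ sending edges to edges; $\Gamma$ is $F$-hom-free if there is no homomorphism $F\to\Gamma$. A map $\phi:V(G)\to V(\Gamma)$ is an $\varepsilon$-approximate homomorphism if all but at most $\varepsilon|G|^2$ edges of $G$ are mapped to edges of $\Gamma$. For graphs $F,H$ with $H\to F$, $M_{F,H}(\varepsilon)$ is the smallest $M$ such that every $H$-hom-free graph has an $\varepsilon$-approximate homomorphism to an $F$-hom-free graph on at most $M$ vertices.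
   Formalization: The parameter $\varepsilon$ ranges over the rationals in $(0,1)$. -}

module Defs where

open import Data.Nat using (ℕ; zero; suc; _+_; _*_; _≤_; _<_; _<ᵇ_)
open import Data.Bool using (Bool; true; false; _∧_; _∨_; if_then_else_)
open import Data.Bool.Properties using (∨-comm)
open import Data.Fin using (Fin; toℕ; splitAt; _≟_)
open import Data.List using (List; []; _∷_; concatMap; length; lookup; map; allFin)
open import Data.Nat.ListAction using (sum)
open import Data.Product using (Σ; _×_; _,_; proj₁; proj₂)
open import Data.Sum using (_⊎_; inj₁; inj₂)
open import Relation.Nullary using (¬_; does)
open import Relation.Binary.PropositionalEquality using (_≡_; refl)

record Graph : Set where
  field
    n     : ℕ
    adj   : Fin n → Fin n → Bool
    sym   : ∀ u v → adj u v ≡ adj v u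
    irrefl : ∀ u → adj u u ≡ false
open Graph public

∣_∣ᵥ : Graph → ℕ
∣ G ∣ᵥ = n G

Hom : Graph → Graph → Set
Hom G Γ = Σ (Fin (n G) → Fin (n Γ)) λ f →
  ∀ u v → adj G u v ≡ true → adj Γ (f u) (f v) ≡ true

HomFree : Graph → Graph → Set
HomFree F Γ = ¬ Hom F Γ

countPairs : (k : ℕ) → (Fin k → Fin k → Bool) → ℕ
countPairs k P = sum (map (λ i → sum (map (λ j →
  if P i j ∧ (toℕ i <ᵇ toℕ j) then 1 else 0) (allFin k))) (allFin k))

badEdges : (G Γ : Graph) → (Fin (n G) → Fin (n Γ)) → ℕ
badEdges G Γ φ = countPairs (n G) λ i j →
  adj G i j ∧ (if adj Γ (φ i) (φ j) then false else true)

edgeList : (F : Graph) → List (Fin (n F) × Fin (n F))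
edgeList F = concatMap (λ i → concatMap (λ j →
  if adj F i j ∧ (toℕ i <ᵇ toℕ j) then (i , j) ∷ [] else []) (allFin (n F))) (allFin (n F))

-- 2-subdivision F•• : vertices are the n vertices of F, then for every edge
-- e = (i , j) (i<j) a vertex aₑ adjacent to i and a vertex bₑ adjacent to j,
-- with aₑ adjacent to bₑ (so each edge becomes the path i – aₑ – bₑ – j).
module _ (F : Graph) where
  private
    E : ℕ
    E = length (edgeList F)
    N : ℕ
    N = n F + (E + E)
    eqB : ∀ {k} → Fin k → Fin k → Bool
    eqB x y = does (x ≟ y)
    sub : Fin (E + E) → Fin E ⊎ Fin E
    sub k = splitAt E k
    A : Fin N → Fin N → Bool
    A u v with splitAt (n F) u | splitAt (n F) v
    ... | inj₁ x | inj₂ k with sub k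
    ...   | inj₁ a = eqB x (proj₁ (lookup (edgeList F) a))
    ...   | inj₂ b = eqB x (proj₂ (lookup (edgeList F) b))
    A u v | inj₂ k | inj₂ l with sub k | sub l
    ...   | inj₁ a | inj₂ b = eqB a b
    ...   | _ | _ = false
    A u v | _ | _ = false
    Aadj : Fin N → Fin N → Bool
    Aadj u v = A u v ∨ A v u
    Asym : ∀ u v → Aadj u v ≡ Aadj v u
    Asym u v = ∨-comm (A u v) (A v u)
    Airr : ∀ u → A u u ≡ false
    Airr u with splitAt (n F) u
    ... | inj₁ x = refl
    ... | inj₂ k with sub k
    ...   | inj₁ a = refl
    ...   | inj₂ b = refl
    Airr2 : ∀ u → Aadj u u ≡ false
    Airr2 u rewrite Airr u = refl
  subdiv2 : Graph
  subdiv2 = record { n = N ; adj = Aadj ; sym = Asym ; irrefl = Airr2 }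

{-# OPTIONS --safe #-}
-- Since H → F••, an H-hom-free graph G admits no homomorphism from F••; in
-- particular it is triangle-free, as F•• maps onto a triangle.  For a list S of
-- vertices of G let Γ_S be the graph on S joining two distinct entries when G
-- has a walk of length 3 between them.  A homomorphism F → Γ_S lifts to
-- F•• → G, so Γ_S is F-hom-free.  Send every vertex of G to one of its
-- neighbours in S: an edge of G with both endpoints dominated by S goes to an
-- edge of Γ_S (the two images differ because G has no triangle), so at most
-- twice the total degree W(S) of the undominated vertices is lost.  Adding to
-- S greedily the vertex that removes the most weight lowers W by at least
-- W²/|G|² (Cauchy–Schwarz), whence t · W ≤ |G|² after t steps; about 2q/p
-- steps give a p/q-approximate homomorphism to an F-hom-free graph of size
-- at most 4q/p.
module Submission where

open import Defs
open import Data.Bool using (Bool; true; false; not; _∧_; _∨_; if_then_else_)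
import Data.Bool.Properties as Bool
open import Data.Empty using (⊥; ⊥-elim)
open import Data.Fin using (Fin; zero; suc; toℕ; splitAt; _≟_)
import Data.Fin.Properties as Fin
open import Data.List using (List; []; _∷_; length; lookup; map; allFin; tabulate)
open import Data.List.Extrema.Nat using (argmax; f[xs]≤f[argmax])
open import Data.List.Membership.Propositional.Properties using (∈-allFin; ∈-lookup)
open import Data.List.Properties using (map-tabulate)
open import Data.List.Relation.Unary.All as All using (All; []; _∷_)
open import Data.List.Relation.Unary.All.Properties using (concat⁺; map⁺; tabulate⁺)
open import Data.List.Relation.Unary.Any as Any using (Any)
open import Data.List.Relation.Unary.Any.Properties using (lookup-index)
open import Data.Nat using (ℕ; zero; suc; _+_; _*_; _≤_; _<_; _<ᵇ_; z≤n; s≤s; NonZero)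
open import Data.Nat.DivMod using (_/_; _%_; m≡m%n+[m/n]*n; m%n<n; m/n*n≤m)
import Data.Nat.ListAction as List
open import Data.Nat.Properties hiding (_≟_)
open import Algebra.Properties.Semiring.Sum +-*-semiring
  using (sum; sum-syntax; sum-cong-≗; ∑-distrib-+; ∑-comm; *-distribˡ-sum; *-distribʳ-sum)
open import Data.Nat.Tactic.RingSolver using (solve-∀)
open import Data.Product using (Σ; ∃₂; _×_; _,_; proj₁; proj₂)
open import Data.Sum using (inj₁; inj₂)
open import Data.Vec.Functional using (Vector)
open import Function using (_∘_)
open import Function.Bundles using (mk⇔)
open import Relation.Nullary using (Dec; yes; no; does; ¬_; ¬?; _×-dec_)
open import Relation.Nullary.Decidable using (does-⇔; dec-true; dec-false)
open import Relation.Binary.PropositionalEquality as ≡ using (_≡_; _≢_; refl; cong; subst; subst₂)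

2ab≤a²+b²-ordered : ∀ {a b} → a ≤ b → 2 * (a * b) ≤ a * a + b * b
2ab≤a²+b²-ordered {a} a≤b with m≤n⇒∃[o]m+o≡n a≤b
... | c , refl = subst (2 * (a * (a + c)) ≤_) (expand a c) (m≤m+n _ (c * c))
  where
  expand : ∀ a c → 2 * (a * (a + c)) + c * c ≡ a * a + (a + c) * (a + c)
  expand = solve-∀

2ab≤a²+b² : ∀ a b → 2 * (a * b) ≤ a * a + b * b
2ab≤a²+b² a b with ≤-total a b
... | inj₁ a≤b = 2ab≤a²+b²-ordered a≤b
... | inj₂ b≤a = subst₂ _≤_ (cong (2 *_) (*-comm b a)) (+-comm (b * b) (a * a)) (2ab≤a²+b²-ordered b≤a)

[1+t]Ma≤M²+[1+t]a² : ∀ M t a → t * a ≤ M → suc t * (M * a) ≤ M * M + suc t * (a * a)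
[1+t]Ma≤M²+[1+t]a² M zero a _ =
  subst₂ _≤_ (≡.sym (*-identityˡ (M * a))) (cong (M * M +_) (≡.sym (*-identityˡ (a * a))))
    (≤-trans (m≤m+n (M * a) (M * a + 0)) (2ab≤a²+b² M a))
[1+t]Ma≤M²+[1+t]a² M (suc t) a ta≤M with m≤n⇒∃[o]m+o≡n ta≤M
... | c , refl = subst (suc (suc t) * ((suc t * a + c) * a) ≤_) (expand t a c)
                   (m≤m+n _ (a * a + t * a * c + c * c))
  where
  expand : ∀ t a c → suc (suc t) * ((suc t * a + c) * a) + (a * a + t * a * c + c * c)
                   ≡ (suc t * a + c) * (suc t * a + c) + suc (suc t) * (a * a)
  expand = solve-∀

-- The induction step showing that a sequence with a_{t+1} ≤ a_t − a_t²/M obeys t · a_t ≤ M.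
decay-step : ∀ M t {a b g} → a ≡ b + g → a * a ≤ M * g → t * a ≤ M → suc t * b ≤ M
decay-step zero t {zero} {b} a≡b+g _ _ rewrite m+n≡0⇒m≡0 b (≡.sym a≡b+g) = ≤-reflexive (*-zeroʳ (suc t))
decay-step zero t {suc a} _ () _
decay-step M@(suc _) t {a} {b} {g} refl a²≤Mg ta≤M = *-cancelˡ-≤ M (begin
  M * (suc t * b)                          ≡⟨ rearrange M t b ⟩
  suc t * (M * b)                          ≤⟨ +-cancelʳ-≤ (suc t * (a * a)) _ _ (begin
    suc t * (M * b) + suc t * (a * a)      ≡⟨ *-distribˡ-+ (suc t) (M * b) (a * a) ⟨
    suc t * (M * b + a * a)                ≤⟨ *-monoʳ-≤ (suc t) (+-monoʳ-≤ (M * b) a²≤Mg) ⟩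
    suc t * (M * b + M * g)                ≡⟨ cong (suc t *_) (*-distribˡ-+ M b g) ⟨
    suc t * (M * a)                        ≤⟨ [1+t]Ma≤M²+[1+t]a² M t a ta≤M ⟩
    M * M + suc t * (a * a)                ∎) ⟩
  M * M                                    ∎)
  where
  open ≤-Reasoning
  rearrange : ∀ M t b → M * (suc t * b) ≡ suc t * (M * b)
  rearrange = solve-∀

m≤[1+m/n]*n : ∀ m n .{{_ : NonZero n}} → m ≤ suc (m / n) * n
m≤[1+m/n]*n m n = begin
  m                     ≡⟨ m≡m%n+[m/n]*n m n ⟩
  m % n + m / n * n     ≤⟨ +-monoˡ-≤ (m / n * n) (<⇒≤ (m%n<n m n)) ⟩
  n + m / n * n         ∎
  where open ≤-Reasoning

m≤2[1+q/p]⇒m*p≤4q : ∀ p q {m} .{{_ : NonZero p}} → p ≤ q → m ≤ 2 * suc (q / p) → m * p ≤ 4 * q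
m≤2[1+q/p]⇒m*p≤4q p q {m} p≤q m≤2[1+q/p] = begin
  m * p                     ≤⟨ *-monoˡ-≤ p m≤2[1+q/p] ⟩
  2 * suc (q / p) * p       ≡⟨ *-assoc 2 (suc (q / p)) p ⟩
  2 * (p + q / p * p)       ≤⟨ *-monoʳ-≤ 2 (+-mono-≤ p≤q (m/n*n≤m q p)) ⟩
  2 * (q + q)               ≡⟨ double q ⟩
  4 * q                     ∎
  where
  open ≤-Reasoning
  double : ∀ q → 2 * (q + q) ≡ 4 * q
  double = solve-∀

[1+q/p]b≤M⇒b*q≤p*M : ∀ p q {b M} .{{_ : NonZero p}} → suc (q / p) * b ≤ M → b * q ≤ p * M
[1+q/p]b≤M⇒b*q≤p*M p q {b} {M} [1+q/p]b≤M = begin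
  b * q                     ≤⟨ *-monoʳ-≤ b (m≤[1+m/n]*n q p) ⟩
  b * (suc (q / p) * p)     ≡⟨ rearrange b (suc (q / p)) p ⟩
  suc (q / p) * b * p       ≤⟨ *-monoˡ-≤ p [1+q/p]b≤M ⟩
  M * p                     ≡⟨ *-comm M p ⟩
  p * M                     ∎
  where
  open ≤-Reasoning
  rearrange : ∀ b k p → b * (k * p) ≡ k * b * p
  rearrange = solve-∀

⟦_⟧ : Bool → ℕ
⟦ b ⟧ = if b then 1 else 0

⟦⟧≤1 : ∀ b → ⟦ b ⟧ ≤ 1
⟦⟧≤1 true = ≤-refl
⟦⟧≤1 false = z≤n

⟦⟧*m≤m : ∀ b m → ⟦ b ⟧ * m ≤ m
⟦⟧*m≤m true m = ≤-reflexive (+-identityʳ m)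
⟦⟧*m≤m false m = z≤n

sum-tabulate : ∀ {k} (f : Vector ℕ k) → List.sum (tabulate f) ≡ sum f
sum-tabulate {zero} f = refl
sum-tabulate {suc k} f = cong (f zero +_) (sum-tabulate (f ∘ suc))

sum-map-allFin : ∀ {k} (f : Vector ℕ k) → List.sum (map f (allFin k)) ≡ sum f
sum-map-allFin f = ≡.trans (cong List.sum (map-tabulate (λ i → i) f)) (sum-tabulate f)

countPairs≡∑∑ : ∀ k (P : Fin k → Fin k → Bool) →
  countPairs k P ≡ ∑[ i < k ] ∑[ j < k ] ⟦ P i j ∧ (toℕ i <ᵇ toℕ j) ⟧
countPairs≡∑∑ k P = ≡.trans (sum-map-allFin λ i → List.sum (map (pair i) (allFin k)))
                             (sum-cong-≗ λ i → sum-map-allFin (pair i))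
  where
  pair : Fin k → Fin k → ℕ
  pair i j = ⟦ P i j ∧ (toℕ i <ᵇ toℕ j) ⟧

sum-mono-≤ : ∀ {k} {f g : Vector ℕ k} → (∀ i → f i ≤ g i) → sum f ≤ sum g
sum-mono-≤ {zero} f≤g = z≤n
sum-mono-≤ {suc k} f≤g = +-mono-≤ (f≤g zero) (sum-mono-≤ (f≤g ∘ suc))

sum-≤-* : ∀ {k} {f : Vector ℕ k} {c} → (∀ i → f i ≤ c) → sum f ≤ k * c
sum-≤-* {zero} f≤c = z≤n
sum-≤-* {suc k} f≤c = +-mono-≤ (f≤c zero) (sum-≤-* (f≤c ∘ suc))

sum-empty : ∀ {k} → ¬ Fin k → (f : Vector ℕ k) → sum f ≡ 0
sum-empty {zero} _ f = refl
sum-empty {suc k} ¬i f = ⊥-elim (¬i zero)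

2a∑f≤ka²+∑f² : ∀ {k} a (f : Vector ℕ k) → 2 * (a * sum f) ≤ k * (a * a) + ∑[ i < k ] (f i * f i)
2a∑f≤ka²+∑f² {zero} a f = ≤-reflexive (cong (2 *_) (*-zeroʳ a))
2a∑f≤ka²+∑f² {suc k} a f =
  subst₂ _≤_ (regroupˡ a (f zero) (sum (f ∘ suc))) (regroupʳ a (f zero) k (∑[ i < k ] (f (suc i) * f (suc i))))
    (+-mono-≤ (2ab≤a²+b² a (f zero)) (2a∑f≤ka²+∑f² a (f ∘ suc)))
  where
  regroupˡ : ∀ a b s → 2 * (a * b) + 2 * (a * s) ≡ 2 * (a * (b + s))
  regroupˡ = solve-∀
  regroupʳ : ∀ a b k q → (a * a + b * b) + (k * (a * a) + q) ≡ suc k * (a * a) + (b * b + q)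
  regroupʳ = solve-∀

cauchy-schwarz : ∀ {k} (f : Vector ℕ k) → sum f * sum f ≤ k * ∑[ i < k ] (f i * f i)
cauchy-schwarz {zero} f = z≤n
cauchy-schwarz {suc k} f =
  subst₂ _≤_ (square a s) (regroup a k (∑[ i < k ] (f (suc i) * f (suc i))))
    (+-monoʳ-≤ (a * a) (+-mono-≤ (2a∑f≤ka²+∑f² a (f ∘ suc)) (cauchy-schwarz (f ∘ suc))))
  where
  a = f zero
  s = sum (f ∘ suc)
  square : ∀ a s → a * a + (2 * (a * s) + s * s) ≡ (a + s) * (a + s)
  square = solve-∀
  regroup : ∀ a k q → a * a + ((k * (a * a) + q) + k * q) ≡ suc k * (a * a + q)
  regroup = solve-∀

Fin-inhabited? : ∀ k → Dec (Fin k)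
Fin-inhabited? zero = no λ ()
Fin-inhabited? (suc k) = yes zero

does-true⇒ : ∀ {P : Set} (p? : Dec P) → does p? ≡ true → P
does-true⇒ (yes p) _ = p

Hom-trans : ∀ {A B C} → Hom A B → Hom B C → Hom A C
Hom-trans (f , f-hom) (g , g-hom) = (λ x → g (f x)) , λ u v uv → g-hom _ _ (f-hom u v uv)

module _ (F : Graph) where

  EdgeIndex : Set
  EdgeIndex = Fin (length (edgeList F))

  source target : EdgeIndex → Fin (n F)
  source e = proj₁ (lookup (edgeList F) e)
  target e = proj₂ (lookup (edgeList F) e)

  edgeList-adj : ∀ e → adj F (source e) (target e) ≡ true
  edgeList-adj e =
    All.lookup (concat⁺ (map⁺ (tabulate⁺ λ i → concat⁺ (map⁺ (tabulate⁺ (listed-adj i)))))) (∈-lookup e)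
    where
    listed-adj : ∀ i j → All (λ (x , y) → adj F x y ≡ true)
                   (if adj F i j ∧ (toℕ i <ᵇ toℕ j) then (i , j) ∷ [] else [])
    listed-adj i j with adj F i j in ij | toℕ i <ᵇ toℕ j
    ... | true  | true  = ij ∷ []
    ... | true  | false = []
    ... | false | _     = []

module _ (G : Graph) where

  private
    N : ℕ
    N = n G

    V : Set
    V = Fin N

  _~_ : V → V → Set
  u ~ v = adj G u v ≡ true

  _~?_ : ∀ u v → Dec (u ~ v)
  u ~? v = adj G u v Bool.≟ true

  ~-sym : ∀ {u v} → u ~ v → v ~ u
  ~-sym {u} {v} = ≡.trans (Graph.sym G v u)

  Walk₃ : V → V → Set
  Walk₃ a b = ∃₂ λ x y → a ~ x × x ~ y × y ~ b

  subdiv2-hom : (F : Graph) (o : Fin (n F) → V) →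
    (∀ e → Walk₃ (o (source F e)) (o (target F e))) → Hom (subdiv2 F) G
  subdiv2-hom F o walk = h , h-hom
    where
    α β : EdgeIndex F → V
    α e = let x , _ = walk e in x
    β e = let _ , y , _ = walk e in y

    oα : ∀ e → o (source F e) ~ α e
    oα e = let _ , _ , ox , _ = walk e in ox
    αβ : ∀ e → α e ~ β e
    αβ e = let _ , _ , _ , xy , _ = walk e in xy
    βo : ∀ e → β e ~ o (target F e)
    βo e = let _ , _ , _ , _ , yo = walk e in yo

    h : Fin (n (subdiv2 F)) → V
    h u with splitAt (n F) u
    ... | inj₁ x = o x
    ... | inj₂ k with splitAt (length (edgeList F)) k
    ...   | inj₁ e = α e
    ...   | inj₂ e = β e

    ≟-true⇒ : ∀ {k} (x y : Fin k) → does (x ≟ y) ≡ true → x ≡ y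
    ≟-true⇒ x y = does-true⇒ (x ≟ y)

    ∨-false-true : ∀ {b} → b ∨ false ≡ true → b ≡ true
    ∨-false-true {true} _ = refl

    -- adj (subdiv2 F) u v unfolds to A u v ∨ A v u, where the half-adjacency A
    -- only points from vertices of F to subdivision vertices and from aₑ to bₑ;
    -- so in each case below one disjunct is false.
    h-hom : ∀ u v → adj (subdiv2 F) u v ≡ true → h u ~ h v
    h-hom u v uv with splitAt (n F) u | splitAt (n F) v
    h-hom u v () | inj₁ x | inj₁ y
    h-hom u v uv | inj₁ x | inj₂ l with splitAt (length (edgeList F)) l
    ... | inj₁ e with refl ← ≟-true⇒ x (source F e) (∨-false-true uv) = oα e
    ... | inj₂ e with refl ← ≟-true⇒ x (target F e) (∨-false-true uv) = ~-sym (βo e)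
    h-hom u v uv | inj₂ k | inj₁ y with splitAt (length (edgeList F)) k
    ... | inj₁ e with refl ← ≟-true⇒ y (source F e) uv = ~-sym (oα e)
    ... | inj₂ e with refl ← ≟-true⇒ y (target F e) uv = βo e
    h-hom u v uv | inj₂ k | inj₂ l with splitAt (length (edgeList F)) k | splitAt (length (edgeList F)) l
    h-hom u v () | inj₂ k | inj₂ l | inj₁ e | inj₁ e′
    ... | inj₁ e | inj₂ e′ with refl ← ≟-true⇒ e e′ (∨-false-true uv) = αβ e′
    ... | inj₂ e | inj₁ e′ with refl ← ≟-true⇒ e′ e uv = ~-sym (αβ e)
    h-hom u v () | inj₂ k | inj₂ l | inj₂ e | inj₂ e′

  walk₃-sym : ∀ {a b} → Walk₃ a b → Walk₃ b a
  walk₃-sym (x , y , ax , xy , yb) = y , x , ~-sym yb , ~-sym xy , ~-sym ax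

  walk₃? : ∀ a b → Dec (Walk₃ a b)
  walk₃? a b = Fin.any? λ x → Fin.any? λ y → a ~? x ×-dec x ~? y ×-dec y ~? b

  Linked : (S : List V) → Fin (length S) → Fin (length S) → Set
  Linked S k l = k ≢ l × Walk₃ (lookup S k) (lookup S l)

  linked? : ∀ S k l → Dec (Linked S k l)
  linked? S k l = ¬? (k ≟ l) ×-dec walk₃? (lookup S k) (lookup S l)

  linked-sym : ∀ S {k l} → Linked S k l → Linked S l k
  linked-sym S (k≢l , w) = (λ l≡k → k≢l (≡.sym l≡k)) , walk₃-sym w

  walkGraph : List V → Graph
  walkGraph S = record
    { n      = length S
    ; adj    = λ k l → does (linked? S k l)
    ; sym    = λ k l → does-⇔ (mk⇔ (linked-sym S) (linked-sym S)) (linked? S k l) (linked? S l k)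
    ; irrefl = λ k → dec-false (linked? S k k) λ (k≢k , _) → k≢k refl
    }

  Dominated : List V → V → Set
  Dominated S y = Any (_~ y) S

  dominated? : ∀ S y → Dec (Dominated S y)
  dominated? S y = Any.any? (_~? y) S

  dominatorIndex : (S : List V) → Fin (length S) → V → Fin (length S)
  dominatorIndex S fallback y with dominated? S y
  ... | yes s~y = Any.index s~y
  ... | no _    = fallback

  dominatorIndex-~ : ∀ S fallback {y} → Dominated S y → lookup S (dominatorIndex S fallback y) ~ y
  dominatorIndex-~ S fallback {y} s~y with dominated? S y
  ... | yes s~y′ = lookup-index s~y′
  ... | no ¬s~y  = ⊥-elim (¬s~y s~y)

  degree : V → ℕ
  degree y = ∑[ z < N ] ⟦ adj G y z ⟧

  undominated : List V → V → ℕ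
  undominated S y = ⟦ not (does (dominated? S y)) ⟧

  undominatedDegree : List V → V → ℕ
  undominatedDegree S y = undominated S y * degree y

  weight : List V → ℕ
  weight S = ∑[ y < N ] undominatedDegree S y

  gain : List V → V → ℕ
  gain S s = ∑[ y < N ] (⟦ adj G s y ⟧ * undominatedDegree S y)

  weight-as-edges : ∀ S → weight S ≡ ∑[ i < N ] ∑[ j < N ] (undominated S i * ⟦ adj G i j ⟧)
  weight-as-edges S = sum-cong-≗ λ i → *-distribˡ-sum (undominated S i) (λ j → ⟦ adj G i j ⟧)

  weight-as-edges′ : ∀ S → weight S ≡ ∑[ i < N ] ∑[ j < N ] (undominated S j * ⟦ adj G i j ⟧)
  weight-as-edges′ S = ≡.trans (weight-as-edges S) (≡.trans (∑-comm λ i j → undominated S i * ⟦ adj G i j ⟧)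
    (sum-cong-≗ λ i → sum-cong-≗ λ j → cong (λ b → undominated S j * ⟦ b ⟧) (Graph.sym G j i)))

  undominatedDegree-∷ : ∀ S s y →
    undominatedDegree S y ≡ undominatedDegree (s ∷ S) y + ⟦ adj G s y ⟧ * undominatedDegree S y
  undominatedDegree-∷ S s y with adj G s y
  ... | true  = ≡.sym (+-identityʳ _)
  ... | false = ≡.sym (+-identityʳ _)

  weight-∷ : ∀ S s → weight S ≡ weight (s ∷ S) + gain S s
  weight-∷ S s = ≡.trans (sum-cong-≗ (undominatedDegree-∷ S s))
    (∑-distrib-+ (undominatedDegree (s ∷ S)) λ y → ⟦ adj G s y ⟧ * undominatedDegree S y)

  ∑gain : ∀ S → ∑[ s < N ] gain S s ≡ ∑[ y < N ] (undominatedDegree S y * degree y)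
  ∑gain S = begin
    ∑[ s < N ] ∑[ y < N ] (⟦ adj G s y ⟧ * ud y) ≡⟨ ∑-comm (λ s y → ⟦ adj G s y ⟧ * ud y) ⟩
    ∑[ y < N ] ∑[ s < N ] (⟦ adj G s y ⟧ * ud y) ≡⟨ sum-cong-≗ (λ y → sum-cong-≗ λ s → cong (λ b → ⟦ b ⟧ * ud y) (Graph.sym G s y)) ⟩
    ∑[ y < N ] ∑[ s < N ] (⟦ adj G y s ⟧ * ud y) ≡⟨ sum-cong-≗ (λ y → *-distribʳ-sum (ud y) (λ s → ⟦ adj G y s ⟧)) ⟨
    ∑[ y < N ] (degree y * ud y)                ≡⟨ sum-cong-≗ (λ y → *-comm (degree y) (ud y)) ⟩
    ∑[ y < N ] (ud y * degree y)                ∎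
    where
    open ≡.≡-Reasoning
    ud = undominatedDegree S

  weight²≤N∑gain : ∀ S → weight S * weight S ≤ N * ∑[ s < N ] gain S s
  weight²≤N∑gain S = begin
    weight S * weight S                     ≤⟨ cauchy-schwarz (undominatedDegree S) ⟩
    N * ∑[ y < N ] (ud y * ud y)            ≤⟨ *-monoʳ-≤ N (sum-mono-≤ λ y → *-monoʳ-≤ (ud y) (⟦⟧*m≤m (not (does (dominated? S y))) (degree y))) ⟩
    N * ∑[ y < N ] (ud y * degree y)        ≡⟨ cong (N *_) (∑gain S) ⟨
    N * ∑[ s < N ] gain S s                 ∎
    where
    open ≤-Reasoning
    ud = undominatedDegree S

  module _ (d : V) where

    best : List V → V
    best S = argmax (gain S) d (allFin N)

    gain≤gain-best : ∀ S s → gain S s ≤ gain S (best S)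
    gain≤gain-best S s = All.lookup (f[xs]≤f[argmax] d (allFin N)) (∈-allFin s)

    greedy : ℕ → List V
    greedy zero = []
    greedy (suc t) = best (greedy t) ∷ greedy t

    length-greedy : ∀ t → length (greedy t) ≡ t
    length-greedy zero = refl
    length-greedy (suc t) = cong suc (length-greedy t)

    weight-greedy : ∀ t → t * weight (greedy t) ≤ N * N
    weight-greedy zero = z≤n
    weight-greedy (suc t) = decay-step (N * N) t (weight-∷ S (best S)) weight²≤N²gain (weight-greedy t)
      where
      S = greedy t
      weight²≤N²gain : weight S * weight S ≤ N * N * gain S (best S)
      weight²≤N²gain = ≤-trans (weight²≤N∑gain S)
        (≤-trans (*-monoʳ-≤ N (sum-≤-* (gain≤gain-best S))) (≤-reflexive (≡.sym (*-assoc N N _))))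

  module _ {F : Graph} (G↛F•• : HomFree (subdiv2 F) G) where

    triangle-free : ∀ {a b c} → a ~ b → b ~ c → c ~ a → ⊥
    triangle-free {a} {b} {c} ab bc ca = G↛F•• (subdiv2-hom F (λ _ → a) λ _ → b , c , ab , bc , ca)

    walkGraph-free : ∀ S → HomFree F (walkGraph S)
    walkGraph-free S (g , g-hom) = G↛F•• (subdiv2-hom F (λ x → lookup S (g x)) walk)
      where
      walk : ∀ e → Walk₃ (lookup S (g (source F e))) (lookup S (g (target F e)))
      walk e = proj₂ (does-true⇒ (linked? S _ _) (g-hom _ _ (edgeList-adj F e)))

    module _ (S : List V) (φ : V → Fin (length S)) (φ-dom : ∀ {y} → Dominated S y → lookup S (φ y) ~ y) where

      dominated-edge-linked : ∀ {i j} → Dominated S i → Dominated S j → i ~ j → Linked S (φ i) (φ j)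
      dominated-edge-linked {i} {j} dom-i dom-j ij = φi≢φj , i , j , φ-dom dom-i , ij , ~-sym (φ-dom dom-j)
        where
        φi≢φj : φ i ≢ φ j
        φi≢φj φi≡φj = triangle-free (φ-dom dom-i) ij (subst (λ k → j ~ lookup S k) (≡.sym φi≡φj) (~-sym (φ-dom dom-j)))

      bad-pair≤ : ∀ i j c → ⟦ (adj G i j ∧ (if adj (walkGraph S) (φ i) (φ j) then false else true)) ∧ c ⟧
                            ≤ undominated S i * ⟦ adj G i j ⟧ + undominated S j * ⟦ adj G i j ⟧
      bad-pair≤ i j c with adj G i j in ij
      ... | false = z≤n
      ... | true with dominated? S i | dominated? S j
      ...   | yes dom-i | yes dom-j rewrite dec-true (linked? S (φ i) (φ j)) (dominated-edge-linked dom-i dom-j ij) = z≤n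
      ...   | no _  | _     = ≤-trans (⟦⟧≤1 _) (s≤s z≤n)
      ...   | yes _ | no _  = ≤-trans (⟦⟧≤1 _) (s≤s z≤n)

      badEdges≤2weight : badEdges G (walkGraph S) φ ≤ 2 * weight S
      badEdges≤2weight = begin
        badEdges G (walkGraph S) φ
          ≡⟨ countPairs≡∑∑ N lost ⟩
        ∑[ i < N ] ∑[ j < N ] ⟦ lost i j ∧ (toℕ i <ᵇ toℕ j) ⟧
          ≤⟨ sum-mono-≤ (λ i → sum-mono-≤ λ j → bad-pair≤ i j _) ⟩
        ∑[ i < N ] ∑[ j < N ] (at-i i j + at-j i j)
          ≡⟨ ≡.trans (sum-cong-≗ λ i → ∑-distrib-+ (at-i i) (at-j i))
                     (∑-distrib-+ (λ i → ∑[ j < N ] at-i i j) (λ i → ∑[ j < N ] at-j i j)) ⟩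
        ∑[ i < N ] ∑[ j < N ] at-i i j + ∑[ i < N ] ∑[ j < N ] at-j i j
          ≡⟨ ≡.cong₂ _+_ (weight-as-edges S) (≡.trans (*-identityˡ (weight S)) (weight-as-edges′ S)) ⟨
        2 * weight S
          ∎
        where
        open ≤-Reasoning
        lost : V → V → Bool
        lost i j = adj G i j ∧ (if adj (walkGraph S) (φ i) (φ j) then false else true)
        at-i at-j : V → V → ℕ
        at-i i j = undominated S i * ⟦ adj G i j ⟧
        at-j i j = undominated S j * ⟦ adj G i j ⟧

    approximation : ∀ k → Σ Graph λ Γ → HomFree F Γ × ∣ Γ ∣ᵥ ≤ 2 * suc k ×
                      Σ (V → Fin (n Γ)) λ φ → suc k * badEdges G Γ φ ≤ N * N
    approximation k with Fin-inhabited? N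
    ... | no ¬v = walkGraph [] , walkGraph-free [] , z≤n , φ , bound
      where
      φ : V → Fin 0
      φ y = ⊥-elim (¬v y)
      bound : suc k * badEdges G (walkGraph []) φ ≤ N * N
      bound = begin
        suc k * badEdges G (walkGraph []) φ  ≤⟨ *-monoʳ-≤ (suc k) (badEdges≤2weight [] φ λ ()) ⟩
        suc k * (2 * weight [])              ≡⟨ cong (λ w → suc k * (2 * w)) (sum-empty ¬v (undominatedDegree [])) ⟩
        suc k * 0                            ≡⟨ *-zeroʳ (suc k) ⟩
        0                                    ≤⟨ z≤n ⟩
        N * N                                ∎
        where open ≤-Reasoning
    ... | yes d = walkGraph S , walkGraph-free S , ≤-reflexive (length-greedy d t) , φ , bound
      where
      t = 2 * suc k
      S = greedy d t
      φ : V → Fin (length S)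
      φ = dominatorIndex S zero
      bound : suc k * badEdges G (walkGraph S) φ ≤ N * N
      bound = begin
        suc k * badEdges G (walkGraph S) φ  ≤⟨ *-monoʳ-≤ (suc k) (badEdges≤2weight S φ (dominatorIndex-~ S zero)) ⟩
        suc k * (2 * weight S)              ≡⟨ *-assoc (suc k) 2 (weight S) ⟨
        suc k * 2 * weight S                ≡⟨ cong (_* weight S) (*-comm (suc k) 2) ⟩
        t * weight S                        ≤⟨ weight-greedy d t ⟩
        N * N                               ∎
        where open ≤-Reasoning

theorem1p12 : (F H : Graph) → Hom H (subdiv2 F) →
    Σ ℕ λ C → (p q : ℕ) → 0 < p → p < q →
      (G : Graph) → HomFree H G →
        Σ Graph λ Γ → HomFree F Γ × (∣ Γ ∣ᵥ * p ≤ C * q) ×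
          Σ (Fin (n G) → Fin (n Γ)) λ φ →
            badEdges G Γ φ * q ≤ p * (∣ G ∣ᵥ * ∣ G ∣ᵥ)
theorem1p12 F H H→F•• = 4 , λ where
  zero _ ()
  p@(suc _) q _ p<q G H↛G →
    let Γ , F↛Γ , ∣Γ∣≤ , φ , bad≤ = approximation G (H↛G ∘ Hom-trans {H} {subdiv2 F} {G} H→F••) (q / p)
    in Γ , F↛Γ , m≤2[1+q/p]⇒m*p≤4q p q (<⇒≤ p<q) ∣Γ∣≤
         , φ , [1+q/p]b≤M⇒b*q≤p*M p q bad≤
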